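{- Consider a position of the game in which Builder and Painter alternately select and colour edges of $K_{\mathbb N}$ (Builder selects an uncoloured edge, Painter colours it red or blue). Let $k\ge 0$ and let $a_0,\dots,a_k\ge 1$ and $b_0,\dots,b_k\ge 0$ be integers with $a_i\ge b_i$ for all $i$. Suppose the current coloured graph contains vertex-disjoint coloured paths $P(a_0,b_0),P(a_1,b_1),\dots,P(a_k,b_k)$. Then Builder has a strategy guaranteeing that within at most $2k$ further rounds the board contains a red triangle $C_3$ or a blue path on $a_0+\sum_{i=1}^k b_i$ vertices.
   Context: For integers $s,t\ge 1$, $P(s,t)$ denotes the coloured path on $s+t$ vertices obtained from two vertex-disjoint blue paths on $s$ and $t$ vertices by joining an end of one to an end of the other with a red edge. $P(s,0)$ denotes a blue path on $s$ vertices. -}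

module Defs where

open import Data.Nat using (ℕ; zero; suc; _+_; _*_; _≤_)
open import Data.Fin using (Fin)
open import Data.List using (List; []; _∷_; length; concat; map; _++_; allFin)
open import Data.List.Membership.Propositional using (_∈_)
open import Data.List.Relation.Unary.All using (All)
open import Data.List.Relation.Unary.AllPairs using (AllPairs)
open import Data.List.Relation.Unary.Unique.Propositional using (Unique)
open import Data.Product using (Σ; ∃; _×_; _,_)
open import Data.Sum using (_⊎_)
open import Data.Unit using (⊤)
open import Data.Empty using (⊥)
open import Relation.Nullary using (¬_)
open import Relation.Binary.PropositionalEquality using (_≡_; _≢_)

data Colour : Set where
  red blue : Colour

ColEdge : Set
ColEdge = ℕ × ℕ × Colour

Board : Set
Board = List ColEdge

Edge : Board → Colour → ℕ → ℕ → Set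
Edge G c u v = ((u , v , c) ∈ G) ⊎ ((v , u , c) ∈ G)

Coloured : Board → ℕ → ℕ → Set
Coloured G u v = ∃ λ c → Edge G c u v

SamePair : ColEdge → ColEdge → Set
SamePair (u , v , _) (u' , v' , _) = ((u ≡ u') × (v ≡ v')) ⊎ ((u ≡ v') × (v ≡ u'))

Valid : Board → Set
Valid G = All (λ { (u , v , _) → u ≢ v }) G × AllPairs (λ e f → ¬ SamePair e f) G

BlueWalk : Board → List ℕ → Set
BlueWalk G [] = ⊤
BlueWalk G (x ∷ []) = ⊤
BlueWalk G (x ∷ y ∷ vs) = Edge G blue x y × BlueWalk G (y ∷ vs)

BluePathOn : Board → ℕ → List ℕ → Set
BluePathOn G n vs = (length vs ≡ n) × Unique vs × BlueWalk G vs

-- The red joining edge of P(s,t): the first blue path xs is listed so that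
-- its head is the end joined to the head of ys.  For t = 0 (ys = []) no red edge.
RedJoin : Board → List ℕ → List ℕ → Set
RedJoin G _ [] = ⊤
RedJoin G [] (_ ∷ _) = ⊥
RedJoin G (x ∷ _) (y ∷ _) = Edge G red x y

-- xs ++ ys spans a copy of P(s,t) in G: blue path xs on s vertices, blue path
-- ys on t vertices (vertex-disjoint), joined by a red edge when t ≥ 1.
IsP : Board → ℕ → ℕ → List ℕ → List ℕ → Set
IsP G s t xs ys =
  BlueWalk G xs × BlueWalk G ys × (length xs ≡ s) × (length ys ≡ t)
  × Unique (xs ++ ys) × RedJoin G xs ys

RedTriangle : Board → Set
RedTriangle G = Σ ℕ λ x → Σ ℕ λ y → Σ ℕ λ z →
  Edge G red x y × Edge G red y z × Edge G red x z

HasBluePath : Board → ℕ → Set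
HasBluePath G n = Σ (List ℕ) λ vs → BluePathOn G n vs

Goal : Board → ℕ → Set
Goal G n = RedTriangle G ⊎ HasBluePath G n

BuilderWins : ℕ → Board → ℕ → Set
BuilderWins zero G n = Goal G n
BuilderWins (suc r) G n = Goal G n ⊎
  (Σ ℕ λ u → Σ ℕ λ v → (u ≢ v) × ¬ Coloured G u v ×
     ((c : Colour) → BuilderWins r ((u , v , c) ∷ G) n))

allVertices : ∀ {k} → (Fin k → List ℕ) → (Fin k → List ℕ) → List ℕ
allVertices {k} xs ys = concat (map (λ i → xs i ++ ys i) (allFin k))

-- Builder keeps a single blue path with a designated free end p, initially the
-- blue path of P(a₀,b₀), and absorbs the other coloured paths one at a time.
-- For P(s,t) with blue halves xs, ys and red edge x–y (x, y their heads),
-- Builder asks for p–y: if it is blue, the path ys is attached through y,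
-- gaining t vertices.  If it is red, he asks for p–x: if blue, the path xs is
-- attached, gaining s ≥ t vertices; if red, then p, x, y span a red triangle.
-- Each absorbed path costs at most two rounds.
module Submission where

open import Defs
open import Data.Nat using (ℕ; zero; suc; _+_; _*_; _≤_; _<_; z≤n; s≤s)
open import Data.Nat.Properties as ℕ using (+-assoc; +-comm; +-identityʳ; *-suc; m≤n⇒m⊓n≡m; ≤-reflexive; ≤-trans; +-monoʳ-≤; +-monoˡ-≤)
open import Data.Fin using (Fin)
open import Data.List using (List; []; _∷_; _++_; _ʳ++_; length; concat; map; take; allFin; tabulate)
open import Data.List.Properties using (length-ʳ++; length-take; ++-assoc; ++-identityʳ; map-tabulate; length-tabulate; tabulate-cong)
open import Data.Nat.ListAction using (sum)
open import Data.List.Membership.Propositional using (_∈_)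
open import Data.List.Membership.Propositional.Properties using (∈-++⁺ʳ)
open import Data.List.Membership.DecPropositional using (_∈?_)
open import Data.List.Relation.Unary.All as All using (All; []; _∷_)
open import Data.List.Relation.Unary.All.Properties using (tabulate⁺)
open import Data.List.Relation.Unary.Any using (here; there)
open import Data.List.Relation.Unary.AllPairs using (_∷_)
open import Data.List.Relation.Unary.Unique.Propositional using (Unique)
open import Data.List.Relation.Unary.Unique.Propositional.Properties using (take⁺; Unique[x∷xs]⇒x∉xs)
open import Data.List.Relation.Binary.Permutation.Propositional using (_↭_; ↭-trans; ↭-reflexive; ↭⇒↭ₛ)
open import Data.List.Relation.Binary.Permutation.Propositional.Properties using (shifts; ++⁺ˡ; ++↭ʳ++)
open import Data.List.Relation.Binary.Permutation.Setoid.Properties using (Unique-resp-↭)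
open import Data.Product using (_×_; _,_)
open import Data.Product.Properties using (≡-dec)
open import Data.Sum using (inj₁; inj₂)
open import Data.Unit using (tt)
open import Relation.Nullary using (¬_; Dec; yes; no)
open import Relation.Nullary.Decidable using (_⊎-dec_)
open import Relation.Binary.Definitions using (DecidableEquality)
open import Relation.Binary.PropositionalEquality using (_≡_; _≢_; refl; sym; trans; cong; cong₂; subst; subst₂; setoid; module ≡-Reasoning)

private
  variable
    A : Set
    G G′ G″ : Board
    n r S : ℕ
    c : Colour
    u v z p : ℕ
    zs M L X Y : List ℕ

Unique-↭ : {xs ys : List A} → xs ↭ ys → Unique xs → Unique ys
Unique-↭ {A = A} xs↭ys = Unique-resp-↭ (setoid A) (↭⇒↭ₛ xs↭ys)

Unique-++⁻ʳ : ∀ (xs : List A) {ys} → Unique (xs ++ ys) → Unique ys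
Unique-++⁻ʳ []       u       = u
Unique-++⁻ʳ (x ∷ xs) (_ ∷ u) = Unique-++⁻ʳ xs u

Unique-removeMiddle : ∀ (xs ys : List A) {zs} → Unique (xs ++ ys ++ zs) → Unique (xs ++ zs)
Unique-removeMiddle xs ys u = Unique-++⁻ʳ ys (Unique-↭ (shifts xs ys) u)

Unique-head≢ : ∀ {x y : A} {xs} → Unique (x ∷ xs) → y ∈ xs → x ≢ y
Unique-head≢ u y∈xs refl = Unique[x∷xs]⇒x∉xs u y∈xs

ʳ++-++-assoc : ∀ (xs : List A) {ys zs} → (xs ʳ++ ys) ++ zs ≡ xs ʳ++ (ys ++ zs)
ʳ++-++-assoc []       = refl
ʳ++-++-assoc (x ∷ xs) = ʳ++-++-assoc xs

Unique-ʳ++ : ∀ (xs ys : List A) {zs} → Unique (xs ++ ys ++ zs) → Unique ((ys ʳ++ xs) ++ zs)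
Unique-ʳ++ xs ys {zs} = Unique-↭ (↭-trans (shifts xs ys)
  (↭-trans (++↭ʳ++ ys (xs ++ zs)) (↭-reflexive (sym (ʳ++-++-assoc ys)))))

_≟ᶜ_ : DecidableEquality Colour
red  ≟ᶜ red  = yes refl
red  ≟ᶜ blue = no λ ()
blue ≟ᶜ red  = no λ ()
blue ≟ᶜ blue = yes refl

_≟ᵉ_ : DecidableEquality ColEdge
_≟ᵉ_ = ≡-dec ℕ._≟_ (≡-dec ℕ._≟_ _≟ᶜ_)

edge? : ∀ G c u v → Dec (Edge G c u v)
edge? G c u v = _∈?_ _≟ᵉ_ (u , v , c) G ⊎-dec _∈?_ _≟ᵉ_ (v , u , c) G

Edge-sym : Edge G c u v → Edge G c v u
Edge-sym (inj₁ e) = inj₂ e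
Edge-sym (inj₂ e) = inj₁ e

BlueWalk-ʳ++ : BlueWalk G (z ∷ zs) → BlueWalk G (z ∷ M) → BlueWalk G (zs ʳ++ z ∷ M)
BlueWalk-ʳ++ {zs = []}     _       w = w
BlueWalk-ʳ++ {zs = _ ∷ _} (e , w₁) w₂ = BlueWalk-ʳ++ w₁ (Edge-sym e , w₂)

BlueWalk-take : ∀ n vs → BlueWalk G vs → BlueWalk G (take n vs)
BlueWalk-take zero          _            _       = tt
BlueWalk-take (suc n)       []           _       = tt
BlueWalk-take (suc zero)    (_ ∷ _)      _       = tt
BlueWalk-take (suc (suc n)) (_ ∷ [])     _       = tt
BlueWalk-take (suc (suc n)) (_ ∷ y ∷ vs) (e , w) = e , BlueWalk-take (suc n) (y ∷ vs) w

BluePath-take : BlueWalk G M → Unique M → n ≤ length M → HasBluePath G n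
BluePath-take {M = M} {n = n} w u n≤ =
  take n M , trans (length-take n M) (m≤n⇒m⊓n≡m n≤) , take⁺ n u , BlueWalk-take n M w

_⊑_ : Board → Board → Set
G ⊑ G′ = ∀ {c u v} → Edge G c u v → Edge G′ c u v

⊑-refl : G ⊑ G
⊑-refl e = e

⊑-trans : G ⊑ G′ → G′ ⊑ G″ → G ⊑ G″
⊑-trans G⊑G′ G′⊑G″ e = G′⊑G″ (G⊑G′ e)

⊑-∷ : ∀ {e} → G ⊑ (e ∷ G)
⊑-∷ (inj₁ e) = inj₁ (there e)
⊑-∷ (inj₂ e) = inj₂ (there e)

BlueWalk-⊑ : G ⊑ G′ → ∀ vs → BlueWalk G vs → BlueWalk G′ vs
BlueWalk-⊑ _    []           _       = tt
BlueWalk-⊑ _    (_ ∷ [])     _       = tt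
BlueWalk-⊑ G⊑G′ (_ ∷ y ∷ vs) (e , w) = G⊑G′ e , BlueWalk-⊑ G⊑G′ (y ∷ vs) w

RedJoin-⊑ : G ⊑ G′ → ∀ xs ys → RedJoin G xs ys → RedJoin G′ xs ys
RedJoin-⊑ _    _       []      _  = tt
RedJoin-⊑ _    []      (_ ∷ _) ()
RedJoin-⊑ G⊑G′ (_ ∷ _) (_ ∷ _) e  = G⊑G′ e

BuilderWins-suc : ∀ r → BuilderWins r G n → BuilderWins (suc r) G n
BuilderWins-suc zero    g        = inj₁ g
BuilderWins-suc (suc r) (inj₁ g) = inj₁ g
BuilderWins-suc (suc r) (inj₂ (u , v , u≢v , uncoloured , next)) =
  inj₂ (u , v , u≢v , uncoloured , λ c → BuilderWins-suc r (next c))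

Goal⇒BuilderWins : ∀ r → Goal G n → BuilderWins r G n
Goal⇒BuilderWins zero    g = g
Goal⇒BuilderWins (suc r) g = inj₁ g

-- If {u,v} is already coloured, Builder learns its colour without spending the round.
BuilderWins-ask : u ≢ v → (∀ {G′} c → G ⊑ G′ → Edge G′ c u v → BuilderWins r G′ n) →
                  BuilderWins (suc r) G n
BuilderWins-ask {u} {v} {G} {r} u≢v next with edge? G blue u v | edge? G red u v
... | yes uv | _      = BuilderWins-suc r (next blue ⊑-refl uv)
... | no _   | yes uv = BuilderWins-suc r (next red ⊑-refl uv)
... | no ¬uv-blue | no ¬uv-red =
  inj₂ (u , v , u≢v , uncoloured , λ c → next c ⊑-∷ (inj₁ (here refl)))
  where
  uncoloured : ¬ Coloured G u v
  uncoloured (red  , uv) = ¬uv-red uv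
  uncoloured (blue , uv) = ¬uv-blue uv

Block : Board → List ℕ → List ℕ → Set
Block G xs ys = BlueWalk G xs × BlueWalk G ys × RedJoin G xs ys × length ys ≤ length xs

Block-⊑ : G ⊑ G′ → Block G X Y → Block G′ X Y
Block-⊑ {X = X} {Y = Y} G⊑G′ (wX , wY , xy , |Y|≤|X|) =
  BlueWalk-⊑ G⊑G′ X wX , BlueWalk-⊑ G⊑G′ Y wY , RedJoin-⊑ G⊑G′ X Y xy , |Y|≤|X|

IsP⇒Block : ∀ {s t} → t ≤ s → IsP G s t X Y → Block G X Y
IsP⇒Block t≤s (wX , wY , |X|≡s , |Y|≡t , _ , xy) = wX , wY , xy , subst₂ _≤_ (sym |Y|≡t) (sym |X|≡s) t≤s

IsP-length₂ : ∀ {s t} → IsP G s t X Y → length Y ≡ t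
IsP-length₂ (_ , _ , _ , |Y|≡t , _) = |Y|≡t

-- The head of M is the end of the main blue path that further paths are attached to.
WinsFromPath : ℕ → Board → List ℕ → ℕ → ℕ → Set
WinsFromPath r G L S n = ∀ {G′} → G ⊑ G′ → ∀ M → 0 < length M → BlueWalk G′ M →
  Unique (M ++ L) → n ≤ length M + S → BuilderWins r G′ n

WinsFromPath-attach : WinsFromPath r G L S n → G ⊑ G′ →
  BlueWalk G (p ∷ M) → BlueWalk G (z ∷ zs) → Edge G′ blue p z →
  Unique ((p ∷ M) ++ (z ∷ zs) ++ L) → n ≤ length (p ∷ M) + (length (z ∷ zs) + S) →
  BuilderWins r G′ n
WinsFromPath-attach {S = S} {n = n} {p = p} {M = M} {z = z} {zs = zs} win G⊑G′ wM wZ pz u n≤ =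
  win G⊑G′ ((z ∷ zs) ʳ++ (p ∷ M))
    (subst (0 <_) (sym (length-ʳ++ (z ∷ zs))) (s≤s z≤n))
    (BlueWalk-ʳ++ (BlueWalk-⊑ G⊑G′ (z ∷ zs) wZ) (Edge-sym pz , BlueWalk-⊑ G⊑G′ (p ∷ M) wM))
    (Unique-ʳ++ (p ∷ M) (z ∷ zs) u)
    (subst (n ≤_) lengths n≤)
  where
  open ≡-Reasoning
  lengths : length (p ∷ M) + (length (z ∷ zs) + S) ≡ length ((z ∷ zs) ʳ++ (p ∷ M)) + S
  lengths = begin
    length (p ∷ M) + (length (z ∷ zs) + S)   ≡⟨ sym (+-assoc (length (p ∷ M)) _ S) ⟩
    length (p ∷ M) + length (z ∷ zs) + S     ≡⟨ cong (_+ S) (+-comm (length (p ∷ M)) _) ⟩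
    length (z ∷ zs) + length (p ∷ M) + S     ≡⟨ cong (_+ S) (sym (length-ʳ++ (z ∷ zs))) ⟩
    length ((z ∷ zs) ʳ++ (p ∷ M)) + S        ∎

WinsFromPath-absorb : WinsFromPath r G L S n → BlueWalk G (p ∷ M) → Block G X Y →
  Unique ((p ∷ M) ++ X ++ Y ++ L) → n ≤ length (p ∷ M) + (length Y + S) →
  BuilderWins (2 + r) G n
WinsFromPath-absorb {r} {p = p} {M} {X} {[]} win w _ u n≤ =
  BuilderWins-suc (suc r) (BuilderWins-suc r
    (win ⊑-refl (p ∷ M) (s≤s z≤n) w (Unique-removeMiddle (p ∷ M) X u) n≤))
WinsFromPath-absorb {X = []} {_ ∷ _} _ _ (_ , _ , () , _) _ _
WinsFromPath-absorb {r} {L = L} {S = S} {n = n} {p = p} {M} {x ∷ X} {y ∷ Y} win w (wX , wY , xy , |Y|≤|X|) u n≤ =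
  BuilderWins-ask {r = suc r} p≢y λ where
    blue G⊑G′ py → BuilderWins-suc r (WinsFromPath-attach win G⊑G′ w wY py uY n≤)
    red  G⊑G′ py → BuilderWins-ask {r = r} p≢x λ where
      blue G′⊑G″ px → WinsFromPath-attach win (⊑-trans G⊑G′ G′⊑G″) w wX px uX n≤′
      red  G′⊑G″ px → Goal⇒BuilderWins r
        (inj₁ (p , y , x , G′⊑G″ py , Edge-sym (G′⊑G″ (G⊑G′ xy)) , px))
  where
  p≢x : p ≢ x
  p≢x = Unique-head≢ u (∈-++⁺ʳ M (here refl))
  p≢y : p ≢ y
  p≢y = Unique-head≢ u (∈-++⁺ʳ M (∈-++⁺ʳ (x ∷ X) (here refl)))
  uY : Unique ((p ∷ M) ++ (y ∷ Y) ++ L)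
  uY = Unique-removeMiddle (p ∷ M) (x ∷ X) u
  uX : Unique ((p ∷ M) ++ (x ∷ X) ++ L)
  uX = Unique-removeMiddle (p ∷ M) (y ∷ Y) (Unique-↭ (++⁺ˡ (p ∷ M) (shifts (x ∷ X) (y ∷ Y))) u)
  n≤′ : n ≤ length (p ∷ M) + (length (x ∷ X) + S)
  n≤′ = ≤-trans n≤ (+-monoʳ-≤ (length (p ∷ M)) (+-monoˡ-≤ S |Y|≤|X|))

BuilderWins-absorbAll : ∀ {I : Set} (X Y : I → List ℕ) is → 0 < length M → BlueWalk G M →
  All (λ i → Block G (X i) (Y i)) is → Unique (M ++ concat (map (λ i → X i ++ Y i) is)) →
  n ≤ length M + sum (map (λ i → length (Y i)) is) → BuilderWins (2 * length is) G n
BuilderWins-absorbAll {M = M} X Y [] _ w [] u n≤ =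
  inj₂ (BluePath-take w (subst Unique (++-identityʳ M) u) (subst (_ ≤_) (+-identityʳ _) n≤))
BuilderWins-absorbAll {M = []} X Y (_ ∷ _) () _ _ _ _
BuilderWins-absorbAll {M = p ∷ M} {G} {n} X Y (i ∷ is) _ w (blk ∷ blks) u n≤ =
  subst (λ r → BuilderWins r G n) (sym (*-suc 2 (length is)))
    (WinsFromPath-absorb win w blk
      (subst (λ l → Unique ((p ∷ M) ++ l)) (++-assoc (X i) (Y i) _) u) n≤)
  where
  win : WinsFromPath (2 * length is) G (concat (map (λ i → X i ++ Y i) is))
                     (sum (map (λ i → length (Y i)) is)) n
  win G⊑G′ _ nonempty w′ u′ n≤′ = BuilderWins-absorbAll X Y is nonempty w′ (All.map (Block-⊑ G⊑G′) blks) u′ n≤′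

lemma2 : (k : ℕ) (a b : Fin (suc k) → ℕ) →
    (∀ i → 1 ≤ a i) → (∀ i → b i ≤ a i) →
    (G : Board) → Valid G →
    (xs ys : Fin (suc k) → List ℕ) →
    (∀ i → IsP G (a i) (b i) (xs i) (ys i)) →
    Unique (allVertices xs ys) →
    BuilderWins (2 * k) G (a Fin.zero + sum (map (λ i → b (Fin.suc i)) (allFin k)))
lemma2 k a b 1≤a b≤a G _ xs ys isP u with isP Fin.zero
... | w₀ , _ , |xs₀|≡a₀ , _ =
  subst (λ m → BuilderWins (2 * m) G target) (length-tabulate {n = k} Fin.suc)
    (BuilderWins-absorbAll xs ys is (subst (0 <_) (sym |xs₀|≡a₀) (1≤a Fin.zero)) w₀
      (tabulate⁺ (λ i → IsP⇒Block (b≤a (Fin.suc i)) (isP (Fin.suc i))))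
      (Unique-removeMiddle (xs Fin.zero) (ys Fin.zero) (subst Unique (++-assoc (xs Fin.zero) _ _) u))
      (≤-reflexive (cong₂ _+_ (sym |xs₀|≡a₀) (cong sum lengths))))
  where
  target : ℕ
  target = a Fin.zero + sum (map (λ i → b (Fin.suc i)) (allFin k))
  is : List (Fin (suc k))
  is = tabulate Fin.suc

  lengths : map (λ i → b (Fin.suc i)) (allFin k) ≡ map (λ i → length (ys i)) is
  lengths = trans (map-tabulate (λ i → i) (λ i → b (Fin.suc i)))
    (trans (tabulate-cong (λ i → sym (IsP-length₂ (isP (Fin.suc i)))))
      (sym (map-tabulate Fin.suc (λ i → length (ys i)))))
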